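{- Let $H$ be a tight product of finite graphs $G_1$ and $G_2$. If $G_2$ has a bridge, then $G_1$ has a perfect matching.
   Context: All graphs are finite, undirected, and may have multiple edges and loops. Degrees count multiple edges with multiplicity, and a loop contributes $2$ to the degree of its vertex; the neighbor set $N_G(v)$ is a multiset. A map $\phi:V(H)\to V(G)$ is a covering map if for every $v\in V(H)$, $\phi$ maps the multiset $N_H(v)$ one-to-one and onto the multiset $N_G(\phi(v))$. A graph $H$ is a tight product of $G_1$ and $G_2$ if $V(H)=V(G_1)\times V(G_2)$ and both coordinate projections are covering maps. A bridge is an edge whose removal increases the number of connected components. -}

module Defs where

open import Data.Nat using (ℕ; zero; suc; _<_)
open import Data.Fin using (Fin; zero; suc; punchIn)
open import Data.Bool using (Bool; true)
open import Data.Product using (Σ; Σ-syntax; ∃; ∃-syntax; _×_; _,_; proj₁; proj₂)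
open import Relation.Binary.PropositionalEquality using (_≡_; _≢_)
open import Relation.Nullary using (¬_)
open import Function.Bundles using (_↔_; Inverse; _⇔_)
open import Function.Definitions using (Surjective)

-- Edges are Fin m; each edge e has two ends  end e 0 , end e 1  (unordered in
-- effect, since everything below treats both ends symmetrically).
record Graph (V : Set) : Set where
  field
    m   : ℕ
    end : Fin m → Fin 2 → V

open Graph public

other : Fin 2 → Fin 2
other zero = suc zero
other (suc _) = zero

-- The multiset N_G(v) is the family of far ends of the darts at v; a loop at v
-- gives two darts, each with far end v (so a loop contributes 2 to the degree).
Dart : ∀ {V} → Graph V → V → Set
Dart G v = Σ[ es ∈ Fin (m G) × Fin 2 ] end G (proj₁ es) (proj₂ es) ≡ v

far : ∀ {V} (G : Graph V) {v : V} → Dart G v → V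
far G ((e , s) , _) = end G e (other s)

-- φ maps the multiset N_H(v) one-to-one and onto N_G(φ v), for every v:
-- a bijection between the index sets of the two multisets that commutes with φ.
IsCovering : ∀ {V W} → Graph V → Graph W → (V → W) → Set
IsCovering H G φ =
  ∀ v → Σ[ f ∈ Dart H v ↔ Dart G (φ v) ]
          (∀ d → φ (far H d) ≡ far G (Inverse.to f d))

IsTightProduct : ∀ {V₁ V₂} → Graph V₁ → Graph V₂ → Graph (V₁ × V₂) → Set
IsTightProduct G₁ G₂ H = IsCovering H G₁ proj₁ × IsCovering H G₂ proj₂

data Connected {V} (G : Graph V) : V → V → Set where
  here : ∀ {v} → Connected G v v
  step : ∀ {u v} (e : Fin (m G)) (s : Fin 2) → end G e s ≡ u →
         Connected G (end G e (other s)) v → Connected G u v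

HasComponents : ∀ {V} → Graph V → ℕ → Set
HasComponents {V} G k =
  Σ[ c ∈ (V → Fin k) ] Surjective _≡_ _≡_ c × (∀ u v → (c u ≡ c v) ⇔ Connected G u v)

private
  delEnds : ∀ {V : Set} {k} → (Fin k → Fin 2 → V) → Fin k → Σ[ j ∈ ℕ ] (Fin j → Fin 2 → V)
  delEnds {k = suc j} en e = j , λ i → en (punchIn e i)

deleteEdge : ∀ {V} (G : Graph V) → Fin (m G) → Graph V
deleteEdge G e = record { m = proj₁ (delEnds (end G) e) ; end = proj₂ (delEnds (end G) e) }

IsBridge : ∀ {V} (G : Graph V) → Fin (m G) → Set
IsBridge G e = Σ[ k ∈ ℕ ] Σ[ k′ ∈ ℕ ]
  HasComponents G k × HasComponents (deleteEdge G e) k′ × k < k′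

HasBridge : ∀ {V} → Graph V → Set
HasBridge G = ∃[ e ] IsBridge G e

Incident : ∀ {V} (G : Graph V) → Fin (m G) → V → Set
Incident G e v = ∃[ s ] end G e s ≡ v

IsPerfectMatching : ∀ {V} (G : Graph V) → (Fin (m G) → Bool) → Set
IsPerfectMatching G M =
  (∀ e → M e ≡ true → end G e zero ≢ end G e (suc zero)) ×
  (∀ v → ∃[ e ] (M e ≡ true × Incident G e v)) ×
  (∀ v e e′ → M e ≡ true → M e′ ≡ true → Incident G e v → Incident G e′ v → e ≡ e′)

HasPerfectMatching : ∀ {V} → Graph V → Set
HasPerfectMatching G = ∃[ M ] IsPerfectMatching G M

module Submission where

-- Let e be a bridge of G₂ and A the side of e containing its first end, so that (e, 0) is
-- the only dart of G₂ from A to its complement. Lifting along the covering H → G₂, for every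
-- vertex x of G₁ exactly one dart of H leaves the column {x} × A for V(G₁) × Aᶜ; let σ x be
-- the G₁-coordinate of its far end. Counting the darts of H from {x} × A to the fibre over y
-- in two ways, via the covering H → G₁, gives
--   |A| · d₁(x, y) = d_H(x, y) + [σ x = y],
-- where d₁ counts darts of G₁ from x to y and d_H darts of H from {x} × A to {y} × A. Both are
-- symmetric in x and y, and even for x = y since every loop carries two darts. Hence σ is an
-- involution without fixed points, and the G₁-edges of the darts x → σ x form a perfect matching.

open import Axiom.UniquenessOfIdentityProofs.WithK using (uip)
open import Data.Bool as Bool using (Bool; true; false)
open import Data.Empty using (⊥-elim)
open import Data.Fin using (Fin; zero; suc; _≟_; _<_; punchOut)
open import Data.Fin.Permutation using (↔⇒≡)
open import Data.Fin.Properties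
  using (+↔⊎; *↔×; any?; _<?_; <-cmp; <-asym; injective⇒≤; punchIn-punchOut)
open import Data.Nat as ℕ using (ℕ; _+_; _*_)
open import Data.Nat.Properties using (+-cancelˡ-≡; +-comm; *-assoc; *-comm; even≢odd; <⇒≱)
open import Data.Product using (Σ; Σ-syntax; ∃; ∃-syntax; _×_; _,_; proj₁; proj₂)
open import Data.Product.Algebra using (×-cong; Σ-assoc)
open import Data.Product.Function.Dependent.Propositional using (Σ-↔)
open import Data.Sum using (_⊎_; inj₁; inj₂; [_,_])
open import Data.Sum.Function.Propositional using (_⊎-↔_)
open import Data.Unit using (⊤; tt)
open import Function using (_∘_)
open import Function.Bundles using (_↔_; Inverse; Equivalence; mk↔ₛ′)
open import Function.Properties.Inverse using (↔-refl; ↔-sym; ↔-trans)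
open import Function.Related.Propositional using (K-reflexive; bijection)
open import Function.Related.TypeIsomorphisms using (×-distribˡ-⊎; Σ-distribˡ-⊎; ∃-≡)
open import Relation.Binary.Definitions using (DecidableEquality; tri<; tri≈; tri>)
open import Relation.Binary.PropositionalEquality
  using (_≡_; _≢_; refl; sym; trans; cong; cong₂; subst; module ≡-Reasoning)
open import Relation.Nullary using (Dec; yes; no; ¬_)
open import Relation.Nullary.Decidable using (does; dec-true; dec-false; _×-dec_)
open import Relation.Nullary.Irrelevant using (Irrelevant)

open import Defs

record Finite (A : Set) : Set where
  field
    card : ℕ
    enum : A ↔ Fin card

open Finite

card-cong : ∀ {A B} → A ↔ B → (p : Finite A) (q : Finite B) → card p ≡ card q
card-cong A↔B p q = ↔⇒≡ (↔-trans (↔-sym (enum p)) (↔-trans A↔B (enum q)))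

finite-↔ : ∀ {A B} → A ↔ B → Finite A → Finite B
finite-↔ A↔B p = record { card = card p ; enum = ↔-trans (↔-sym A↔B) (enum p) }

finite-Fin : ∀ n → Finite (Fin n)
finite-Fin n = record { card = n ; enum = ↔-refl }

finite-⊎ : ∀ {A B} → Finite A → Finite B → Finite (A ⊎ B)
finite-⊎ p q = record
  { card = card p + card q
  ; enum = ↔-trans (enum p ⊎-↔ enum q) (↔-sym (+↔⊎ {card p})) }

finite-× : ∀ {A B} → Finite A → Finite B → Finite (A × B)
finite-× p q = record
  { card = card p * card q
  ; enum = ↔-trans (×-cong (enum p) (enum q)) (↔-sym (*↔× {card p})) }

finite-prop : ∀ {P} → Irrelevant P → Dec P → Finite P
finite-prop irr (yes p) = record
  { card = 1 ; enum = mk↔ₛ′ (λ _ → zero) (λ _ → p) (λ { zero → refl ; (suc ()) }) (irr p) }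
finite-prop irr (no ¬p) = record
  { card = 0 ; enum = mk↔ₛ′ (λ p → ⊥-elim (¬p p)) (λ ()) (λ ()) (λ p → ⊥-elim (¬p p)) }

finite-≡ : ∀ {A : Set} → DecidableEquality A → (x y : A) → Finite (x ≡ y)
finite-≡ _≟_ x y = finite-prop uip (x ≟ y)

Σ-Fin-suc↔ : ∀ {n} {P : Fin (ℕ.suc n) → Set} → Σ (Fin (ℕ.suc n)) P ↔ (P zero ⊎ Σ (Fin n) (P ∘ suc))
Σ-Fin-suc↔ = mk↔ₛ′
  (λ { (zero , p) → inj₁ p ; (suc i , p) → inj₂ (i , p) })
  (λ { (inj₁ p) → zero , p ; (inj₂ (i , p)) → suc i , p })
  (λ { (inj₁ _) → refl ; (inj₂ _) → refl })
  (λ { (zero , _) → refl ; (suc _ , _) → refl })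

finite-Σ-Fin : ∀ n {P : Fin n → Set} → (∀ i → Finite (P i)) → Finite (Σ (Fin n) P)
finite-Σ-Fin ℕ.zero _ = record { card = 0 ; enum = mk↔ₛ′ (λ ()) (λ ()) (λ ()) (λ ()) }
finite-Σ-Fin (ℕ.suc n) fin =
  finite-↔ (↔-sym Σ-Fin-suc↔) (finite-⊎ (fin zero) (finite-Σ-Fin n (fin ∘ suc)))

finite-Σ : ∀ {A} {P : A → Set} → Finite A → (∀ a → Finite (P a)) → Finite (Σ A P)
finite-Σ p fin =
  finite-↔ (Σ-↔ (↔-sym (enum p)) ↔-refl) (finite-Σ-Fin (card p) (fin ∘ Inverse.from (enum p)))

card-finite-≡ : ∀ {A : Set} (_≟_ : DecidableEquality A) {a b : A} →
  a ≡ b → card (finite-≡ _≟_ a b) ≡ 1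
card-finite-≡ _≟_ {a} {b} a≡b with a ≟ b
... | yes _  = refl
... | no a≢b = ⊥-elim (a≢b a≡b)

≡-from-card : ∀ {A : Set} (_≟_ : DecidableEquality A) {a b c d : A} →
  card (finite-≡ _≟_ a b) ≡ card (finite-≡ _≟_ c d) → a ≡ b → c ≡ d
≡-from-card _≟_ {c = c} {d} same a≡b with c ≟ d
... | yes c≡d = c≡d
... | no _ with () ← trans (sym (card-finite-≡ _≟_ a≡b)) same

does-true⇒ : ∀ {P : Set} (P? : Dec P) → does P? ≡ true → P
does-true⇒ (yes p) _ = p

does-false⇒ : ∀ {P : Set} (P? : Dec P) → does P? ≡ false → ¬ P
does-false⇒ (no ¬p) _ = ¬p

split-by-Bool : (X : Set) (b : Bool) → X ↔ ((X × b ≡ true) ⊎ (X × b ≡ false))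
split-by-Bool X true = mk↔ₛ′ (λ x → inj₁ (x , refl)) [ proj₁ , proj₁ ]
  (λ { (inj₁ (_ , refl)) → refl ; (inj₂ (_ , ())) }) (λ _ → refl)
split-by-Bool X false = mk↔ₛ′ (λ x → inj₂ (x , refl)) [ proj₁ , proj₁ ]
  (λ { (inj₁ (_ , ())) ; (inj₂ (_ , refl)) → refl }) (λ _ → refl)

Σ-contract : ∀ {A : Set} {P : A → Set} (A↔⊤ : A ↔ ⊤) → Σ A P ↔ P (Inverse.from A↔⊤ tt)
Σ-contract {A} {P} A↔⊤ = mk↔ₛ′ to (centre ,_) (λ p → cong (λ e → subst P e p) (uip _ refl)) from∘to
  where
  centre : A
  centre = Inverse.from A↔⊤ tt
  contract : ∀ a → a ≡ centre
  contract a = sym (Inverse.strictlyInverseʳ A↔⊤ a)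
  to : Σ A P → P centre
  to (a , p) = subst P (contract a) p
  transport : ∀ {a b} (e : a ≡ b) (p : P a) → (b , subst P e p) ≡ (a , p)
  transport refl p = refl
  from∘to : ∀ x → (centre , to x) ≡ x
  from∘to (a , p) = transport (contract a) p

Σ-column↔ : ∀ {V₁ V₂ : Set} (x : V₁) (A : V₂ → Set) (F : V₁ × V₂ → Set) →
  (Σ[ u ∈ V₁ × V₂ ] (proj₁ u ≡ x × A (proj₂ u)) × F u) ↔ (Σ[ v ∈ V₂ ] A v × F (x , v))
Σ-column↔ x A F = mk↔ₛ′
  (λ { ((_ , v) , (refl , a) , f) → v , a , f })
  (λ (v , a , f) → (x , v) , (refl , a) , f)
  (λ _ → refl)
  (λ { (_ , (refl , _) , _) → refl })

module _ {V : Set} (G : Graph V) where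

  DartsBetween : (V → Set) → (V → Set) → Set
  DartsBetween S T = Σ[ e ∈ Fin (m G) ] Σ[ s ∈ Fin 2 ] S (end G e s) × T (end G e (other s))

  DartsTo : V → (V → Set) → Set
  DartsTo v T = Σ[ d ∈ Dart G v ] T (far G d)

  Loops : (V → Set) → Set
  Loops S = Σ[ e ∈ Fin (m G) ] S (end G e zero) × S (end G e (suc zero))

  farEnd : ∀ {S T} → DartsBetween S T → V
  farEnd (e , s , _) = end G e (other s)

  finite-DartsBetween : ∀ {S T} → (∀ v → Finite (S v)) → (∀ v → Finite (T v)) →
                        Finite (DartsBetween S T)
  finite-DartsBetween finS finT =
    finite-Σ (finite-Fin (m G)) λ e → finite-Σ (finite-Fin 2) λ s →
      finite-× (finS (end G e s)) (finT (end G e (other s)))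

  finite-Loops : ∀ {S} → (∀ v → Finite (S v)) → Finite (Loops S)
  finite-Loops finS =
    finite-Σ (finite-Fin (m G)) λ e → finite-× (finS (end G e zero)) (finS (end G e (suc zero)))

  DartsWithin↔2×Loops : (S : V → Set) → DartsBetween S S ↔ (Fin 2 × Loops S)
  DartsWithin↔2×Loops S = mk↔ₛ′
    (λ { (e , zero , p , q) → zero , e , p , q ; (e , suc zero , p , q) → suc zero , e , q , p })
    (λ { (zero , e , p , q) → e , zero , p , q ; (suc zero , e , p , q) → e , suc zero , q , p })
    (λ { (zero , _) → refl ; (suc zero , _) → refl })
    (λ { (_ , zero , _) → refl ; (_ , suc zero , _) → refl })

  module _ (S T : V → Set) where

    DartsBetween-swap : DartsBetween S T ↔ DartsBetween T S
    DartsBetween-swap = mk↔ₛ′ (reverse S T) (reverse T S) (reverse-involutive T S) (reverse-involutive S T)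
      where
      reverse : ∀ P Q → DartsBetween P Q → DartsBetween Q P
      reverse P Q (e , zero , p , q) = e , suc zero , q , p
      reverse P Q (e , suc zero , p , q) = e , zero , q , p
      reverse-involutive : ∀ P Q (d : DartsBetween P Q) → reverse Q P (reverse P Q d) ≡ d
      reverse-involutive P Q (e , zero , _) = refl
      reverse-involutive P Q (e , suc zero , _) = refl

    DartsBetween↔ΣDartsTo : DartsBetween S T ↔ (Σ[ v ∈ V ] S v × DartsTo v T)
    DartsBetween↔ΣDartsTo = mk↔ₛ′ split join split∘join (λ _ → refl)
      where
      split : DartsBetween S T → Σ[ v ∈ V ] S v × DartsTo v T
      split (e , s , p , q) = end G e s , p , ((e , s) , refl) , q
      join : Σ[ v ∈ V ] S v × DartsTo v T → DartsBetween S T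
      join (_ , p , ((e , s) , refl) , q) = e , s , p , q
      split∘join : ∀ x → split (join x) ≡ x
      split∘join (_ , _ , (_ , refl) , _) = refl

    DartsBetween-∩ : (U : V → Set) →
      DartsBetween S (λ v → T v × U v) ↔ (Σ[ d ∈ DartsBetween S U ] T (farEnd {S} {U} d))
    DartsBetween-∩ U = mk↔ₛ′
      (λ (e , s , p , q , r) → (e , s , p , r) , q)
      (λ ((e , s , p , r) , q) → e , s , p , q , r)
      (λ _ → refl)
      (λ _ → refl)

    -- The side is Bool-valued so that the complement, side v ≡ false, is proof-irrelevant
    -- (a negation ¬ (v ∈ A) would not be, without function extensionality).
    DartsBetween-split : (side : V → Bool) →
      DartsBetween S T ↔
      (DartsBetween S (λ v → T v × side v ≡ true) ⊎ DartsBetween S (λ v → T v × side v ≡ false))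
    DartsBetween-split side =
      ↔-trans (Σ-↔ ↔-refl (↔-trans (Σ-↔ ↔-refl split-ends) Σ-distribˡ-⊎)) Σ-distribˡ-⊎
      where
      split-ends : ∀ {e s} → (S (end G e s) × T (end G e (other s))) ↔
        ((S (end G e s) × T (end G e (other s)) × side (end G e (other s)) ≡ true) ⊎
         (S (end G e s) × T (end G e (other s)) × side (end G e (other s)) ≡ false))
      split-ends = ↔-trans (×-cong ↔-refl (split-by-Bool _ _)) ×-distribˡ-⊎

covering-DartsTo : ∀ {VH VG} {H : Graph VH} {G : Graph VG} {φ : VH → VG} →
  IsCovering H G φ → (T : VG → Set) (u : VH) → DartsTo H u (T ∘ φ) ↔ DartsTo G (φ u) T
covering-DartsTo cov T u = Σ-↔ (proj₁ (cov u)) (K-reflexive {k = bijection} (cong T (proj₂ (cov u) _)))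

covering-DartsBetween : ∀ {VH VG} {H : Graph VH} {G : Graph VG} {φ : VH → VG} →
  IsCovering H G φ → (S : VH → Set) (T : VG → Set) →
  DartsBetween H S (T ∘ φ) ↔ (Σ[ u ∈ VH ] S u × DartsTo G (φ u) T)
covering-DartsBetween {H = H} {φ = φ} cov S T =
  ↔-trans (DartsBetween↔ΣDartsTo H S (T ∘ φ)) (Σ-↔ ↔-refl (×-cong ↔-refl (covering-DartsTo cov T _)))

DartsBetween-point↔DartsTo : ∀ {V} (G : Graph V) (x : V) (T : V → Set) →
  DartsBetween G (_≡ x) T ↔ DartsTo G x T
DartsBetween-point↔DartsTo G x T =
  ↔-trans (DartsBetween↔ΣDartsTo G (_≡ x) T) (↔-sym (∃-≡ (λ v → DartsTo G v T)))

other-involutive : ∀ s → other (other s) ≡ s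
other-involutive zero = refl
other-involutive (suc zero) = refl

module _ {V : Set} {G : Graph V} where

  Connected-trans : ∀ {u v w} → Connected G u v → Connected G v w → Connected G u w
  Connected-trans here q = q
  Connected-trans (step f s p r) q = step f s p (Connected-trans r q)

  Connected-edge : ∀ f s → Connected G (end G f s) (end G f (other s))
  Connected-edge f s = step f s refl here

  Connected-sym : ∀ {u v} → Connected G u v → Connected G v u
  Connected-sym here = here
  Connected-sym (step f s refl r) =
    Connected-trans (Connected-sym r)
      (subst (λ t → Connected G (end G f (other s)) (end G f t)) (other-involutive s)
        (Connected-edge f (other s)))

deleteEdge-connects : ∀ {V} (G : Graph V) {e f : Fin (m G)} → f ≢ e →
  ∀ s → Connected (deleteEdge G e) (end G f s) (end G f (other s))
deleteEdge-connects G = go (m G) (end G)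
  where
  -- deleteEdge only computes once the number of edges is a successor.
  go : ∀ {V} k (en : Fin k → Fin 2 → V) {e f : Fin k} → f ≢ e →
       ∀ s → Connected (deleteEdge (record { m = k ; end = en }) e) (en f s) (en f (other s))
  go (ℕ.suc k) en f≢e s =
    subst (λ g → Connected _ (en g s) (en g (other s)))
      (punchIn-punchOut (f≢e ∘ sym)) (Connected-edge (punchOut (f≢e ∘ sym)) s)

components-≤ : ∀ {V} {G G′ : Graph V} {k k′} → HasComponents G k → HasComponents G′ k′ →
  (∀ {u v} → Connected G u v → Connected G′ u v) → k′ ℕ.≤ k
components-≤ (c , _ , c-conn) (c′ , c′-surj , c′-conn) G⊆G′ = injective⇒≤ {f = c ∘ rep} rep-injective
  where
  rep = λ j → proj₁ (c′-surj j)
  rep-injective : ∀ {i j} → c (rep i) ≡ c (rep j) → i ≡ j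
  rep-injective {i} {j} same = begin
    i            ≡⟨ sym (proj₂ (c′-surj i) refl) ⟩
    c′ (rep i)   ≡⟨ Equivalence.from (c′-conn _ _) (G⊆G′ (Equivalence.to (c-conn _ _) same)) ⟩
    c′ (rep j)   ≡⟨ proj₂ (c′-surj j) refl ⟩
    j            ∎
    where open ≡-Reasoning

bridge-separates : ∀ {V} (G : Graph V) {e} → IsBridge G e →
  ¬ Connected (deleteEdge G e) (end G e zero) (end G e (suc zero))
bridge-separates G {e} (_ , _ , comps , comps′ , k<k′) a~b =
  <⇒≱ k<k′ (components-≤ comps comps′ lift)
  where
  edge-survives : ∀ f s → Connected (deleteEdge G e) (end G f s) (end G f (other s))
  edge-survives f s with f ≟ e
  edge-survives f zero       | yes refl = a~b
  edge-survives f (suc zero) | yes refl = Connected-sym a~b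
  ... | no f≢e = deleteEdge-connects G f≢e s
  lift : ∀ {u v} → Connected G u v → Connected (deleteEdge G e) u v
  lift here = here
  lift (step f s refl r) = Connected-trans (edge-survives f s) (lift r)

bridge⇒single-crossing : ∀ {n} (G : Graph (Fin n)) {e} → IsBridge G e →
  Σ[ side ∈ (Fin n → Bool) ] (DartsBetween G (λ v → side v ≡ true) (λ v → side v ≡ false) ↔ ⊤)
bridge⇒single-crossing {n} G {e} bridge@(_ , _ , _ , (c′ , _ , c′-conn) , _) =
  side , mk↔ₛ′ _ (λ _ → crossing) (λ _ → refl) only-crossing
  where
  a b : Fin n
  a = end G e zero
  b = end G e (suc zero)
  side : Fin n → Bool
  side v = does (c′ v ≟ c′ a)
  b≁a : ¬ c′ b ≡ c′ a
  b≁a b~a = bridge-separates G bridge (Connected-sym (Equivalence.to (c′-conn b a) b~a))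
  crossing : DartsBetween G (λ v → side v ≡ true) (λ v → side v ≡ false)
  crossing = e , zero , dec-true (c′ a ≟ c′ a) refl , dec-false (c′ b ≟ c′ a) b≁a
  only-crossing : ∀ d → crossing ≡ d
  only-crossing (f , s , p , q) with f ≟ e
  only-crossing (f , s , p , q) | no f≢e =
    ⊥-elim (does-false⇒ (_ ≟ _) q (trans (Equivalence.from (c′-conn _ _)
      (Connected-sym (deleteEdge-connects G f≢e s))) (does-true⇒ (_ ≟ _) p)))
  only-crossing (e , zero , p , q) | yes refl = cong₂ (λ p q → e , zero , p , q) (uip _ _) (uip _ _)
  only-crossing (e , suc zero , p , _) | yes refl = ⊥-elim (b≁a (does-true⇒ (_ ≟ _) p))

module _ {n} (G : Graph (Fin n)) (σ : Fin n → Fin n)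
  (σ-involutive : ∀ x → σ (σ x) ≡ x) (σ-no-fixed-point : ∀ x → ¬ σ x ≡ x)
  (link : ∀ x → DartsBetween G (_≡ x) (_≡ σ x))
  where

  private
    edge : Fin n → Fin (m G)
    edge x = proj₁ (link x)

    link-ends : ∀ x {v} → Incident G (edge x) v → v ≡ x ⊎ v ≡ σ x
    link-ends x (t , refl) with link x
    link-ends x (zero , refl)     | _ , zero , p , _     = inj₁ p
    link-ends x (suc zero , refl) | _ , zero , _ , q     = inj₂ q
    link-ends x (zero , refl)     | _ , suc zero , _ , q = inj₂ q
    link-ends x (suc zero , refl) | _ , suc zero , p , _ = inj₁ p

    link-incident : ∀ x → Incident G (edge x) x × Incident G (edge x) (σ x)
    link-incident x with link x
    ... | _ , s , p , q = (s , p) , (other s , q)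

    link-not-loop : ∀ x → ¬ end G (edge x) zero ≡ end G (edge x) (suc zero)
    link-not-loop x loop with link x
    ... | _ , zero , p , q     = σ-no-fixed-point x (trans (sym q) (trans (sym loop) p))
    ... | _ , suc zero , p , q = σ-no-fixed-point x (trans (sym q) (trans loop p))

    Chosen : Fin (m G) → Fin n → Set
    Chosen f x = x < σ x × f ≡ edge x

    chosen? : ∀ f → Dec (∃ (Chosen f))
    chosen? f = any? (λ x → (x <? σ x) ×-dec (f ≟ edge x))

    matching : Fin (m G) → Bool
    matching f = does (chosen? f)

    chosen : ∀ {f} → matching f ≡ true → ∃ (Chosen f)
    chosen {f} = does-true⇒ (chosen? f)

    choose : ∀ {f} x → Chosen f x → matching f ≡ true
    choose {f} x c = dec-true (chosen? f) (x , c)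

    crossed : ∀ {x y} → σ y ≡ x → x < σ x → ¬ y < σ y
    crossed {x} {y} σy≡x x<σx y<σy = <-asym (subst (x <_) σx≡y x<σx) (subst (y <_) σy≡x y<σy)
      where σx≡y = trans (cong σ (sym σy≡x)) (σ-involutive y)

    representative-unique : ∀ {v x y} → x < σ x → y < σ y →
      v ≡ x ⊎ v ≡ σ x → v ≡ y ⊎ v ≡ σ y → x ≡ y
    representative-unique _ _ (inj₁ p) (inj₁ q) = trans (sym p) q
    representative-unique x<σx y<σy (inj₁ p) (inj₂ q) = ⊥-elim (crossed (trans (sym q) p) x<σx y<σy)
    representative-unique x<σx y<σy (inj₂ p) (inj₁ q) = ⊥-elim (crossed (trans (sym p) q) y<σy x<σx)
    representative-unique {x = x} {y} _ _ (inj₂ p) (inj₂ q) =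
      trans (sym (σ-involutive x)) (trans (cong σ (trans (sym p) q)) (σ-involutive y))

  involution⇒perfect-matching : HasPerfectMatching G
  involution⇒perfect-matching = matching , no-loop , covers , unique
    where
    no-loop : ∀ f → matching f ≡ true → ¬ end G f zero ≡ end G f (suc zero)
    no-loop f mf with chosen mf
    ... | x , _ , refl = link-not-loop x

    covers : ∀ v → ∃[ f ] (matching f ≡ true × Incident G f v)
    covers v with <-cmp v (σ v)
    ... | tri< v<σv _ _ = edge v , choose v (v<σv , refl) , proj₁ (link-incident v)
    ... | tri≈ _ v≡σv _ = ⊥-elim (σ-no-fixed-point v (sym v≡σv))
    ... | tri> _ _ σv<v =
      edge (σ v) , choose (σ v) (subst (σ v <_) (sym (σ-involutive v)) σv<v , refl) ,
      subst (Incident G (edge (σ v))) (σ-involutive v) (proj₂ (link-incident (σ v)))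

    unique : ∀ v f f′ → matching f ≡ true → matching f′ ≡ true →
             Incident G f v → Incident G f′ v → f ≡ f′
    unique v f f′ mf mf′ f∋v f′∋v with chosen mf | chosen mf′
    ... | x , x<σx , refl | y , y<σy , refl =
      cong edge (representative-unique x<σx y<σy (link-ends x f∋v) (link-ends y f′∋v))

module ColumnCounting
  {n₁ n₂} {G₁ : Graph (Fin n₁)} {G₂ : Graph (Fin n₂)} {H : Graph (Fin n₁ × Fin n₂)}
  (cov₁ : IsCovering H G₁ proj₁) (cov₂ : IsCovering H G₂ proj₂)
  (side : Fin n₂ → Bool)
  (single-crossing : DartsBetween G₂ (λ v → side v ≡ true) (λ v → side v ≡ false) ↔ ⊤)
  where

  Inside Outside : Fin n₂ → Set
  Inside v = side v ≡ true
  Outside v = side v ≡ false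

  Column : Fin n₁ → Fin n₁ × Fin n₂ → Set
  Column x u = proj₁ u ≡ x × Inside (proj₂ u)

  Fibre : Fin n₁ → Fin n₁ × Fin n₂ → Set
  Fibre y u = proj₁ u ≡ y

  leaving↔⊤ : ∀ x → DartsBetween H (Column x) (Outside ∘ proj₂) ↔ ⊤
  leaving↔⊤ x =
    ↔-trans (covering-DartsBetween cov₂ (Column x) Outside)
    (↔-trans (Σ-column↔ x Inside (λ u → DartsTo G₂ (proj₂ u) Outside))
    (↔-trans (↔-sym (DartsBetween↔ΣDartsTo G₂ Inside Outside)) single-crossing))

  σ : Fin n₁ → Fin n₁
  σ x = proj₁ (farEnd H {Column x} {Outside ∘ proj₂} (Inverse.from (leaving↔⊤ x) tt))

  leaving-to-fibre↔ : ∀ x y →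
    DartsBetween H (Column x) (λ u → Fibre y u × Outside (proj₂ u)) ↔ (σ x ≡ y)
  leaving-to-fibre↔ x y =
    ↔-trans (DartsBetween-∩ H (Column x) (Fibre y) (Outside ∘ proj₂)) (Σ-contract (leaving↔⊤ x))

  column-to-fibre↔ : ∀ x y →
    DartsBetween H (Column x) (Fibre y) ↔ (Σ (Fin n₂) Inside × DartsBetween G₁ (_≡ x) (_≡ y))
  column-to-fibre↔ x y =
    ↔-trans (covering-DartsBetween cov₁ (Column x) (_≡ y))
    (↔-trans (Σ-column↔ x Inside (λ u → DartsTo G₁ (proj₁ u) (_≡ y)))
    (↔-trans (↔-sym Σ-assoc) (×-cong ↔-refl (↔-sym (DartsBetween-point↔DartsTo G₁ x (_≡ y))))))

  column-to-fibre-split : ∀ x y →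
    DartsBetween H (Column x) (Fibre y) ↔ (DartsBetween H (Column x) (Column y) ⊎ (σ x ≡ y))
  column-to-fibre-split x y =
    ↔-trans (DartsBetween-split H (Column x) (Fibre y) (side ∘ proj₂))
            (↔-refl ⊎-↔ leaving-to-fibre↔ x y)

  finite-point : (x v : Fin n₁) → Finite (v ≡ x)
  finite-point x v = finite-≡ _≟_ v x

  finite-Column : ∀ x u → Finite (Column x u)
  finite-Column x u = finite-× (finite-point x (proj₁ u)) (finite-≡ Bool._≟_ (side (proj₂ u)) true)

  finite-Inside : Finite (Σ (Fin n₂) Inside)
  finite-Inside = finite-Σ (finite-Fin n₂) (λ v → finite-≡ Bool._≟_ (side v) true)

  #inside : ℕ
  #inside = card finite-Inside

  #G₁ : Fin n₁ → Fin n₁ → ℕ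
  #G₁ x y = card (finite-DartsBetween G₁ (finite-point x) (finite-point y))

  #H : Fin n₁ → Fin n₁ → ℕ
  #H x y = card (finite-DartsBetween H (finite-Column x) (finite-Column y))

  [σ_≡_] : Fin n₁ → Fin n₁ → ℕ
  [σ x ≡ y ] = card (finite-≡ _≟_ (σ x) y)

  -- Both sides count the darts of H from the column {x} × A to the fibre over y.
  double-count : ∀ x y → #H x y + [σ x ≡ y ] ≡ #inside * #G₁ x y
  double-count x y =
    card-cong (↔-trans (↔-sym (column-to-fibre-split x y)) (column-to-fibre↔ x y))
      (finite-⊎ (finite-DartsBetween H (finite-Column x) (finite-Column y)) (finite-≡ _≟_ (σ x) y))
      (finite-× finite-Inside (finite-DartsBetween G₁ (finite-point x) (finite-point y)))

  #G₁-sym : ∀ x y → #G₁ x y ≡ #G₁ y x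
  #G₁-sym x y = card-cong (DartsBetween-swap G₁ (_≡ x) (_≡ y))
    (finite-DartsBetween G₁ (finite-point x) (finite-point y))
    (finite-DartsBetween G₁ (finite-point y) (finite-point x))

  #H-sym : ∀ x y → #H x y ≡ #H y x
  #H-sym x y = card-cong (DartsBetween-swap H (Column x) (Column y))
    (finite-DartsBetween H (finite-Column x) (finite-Column y))
    (finite-DartsBetween H (finite-Column y) (finite-Column x))

  #G₁-self : ∀ x → #G₁ x x ≡ 2 * card (finite-Loops G₁ (finite-point x))
  #G₁-self x = card-cong (DartsWithin↔2×Loops G₁ (_≡ x))
    (finite-DartsBetween G₁ (finite-point x) (finite-point x))
    (finite-× (finite-Fin 2) (finite-Loops G₁ (finite-point x)))

  #H-self : ∀ x → #H x x ≡ 2 * card (finite-Loops H (finite-Column x))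
  #H-self x = card-cong (DartsWithin↔2×Loops H (Column x))
    (finite-DartsBetween H (finite-Column x) (finite-Column x))
    (finite-× (finite-Fin 2) (finite-Loops H (finite-Column x)))

  σ-symmetric : ∀ x y → σ x ≡ y → σ y ≡ x
  σ-symmetric x y = ≡-from-card _≟_ (+-cancelˡ-≡ (#H x y) _ _ (begin
    #H x y + [σ x ≡ y ]     ≡⟨ double-count x y ⟩
    #inside * #G₁ x y       ≡⟨ cong (#inside *_) (#G₁-sym x y) ⟩
    #inside * #G₁ y x       ≡⟨ sym (double-count y x) ⟩
    #H y x + [σ y ≡ x ]     ≡⟨ cong (_+ [σ y ≡ x ]) (#H-sym y x) ⟩
    #H x y + [σ y ≡ x ]     ∎))
    where open ≡-Reasoning

  σ-no-fixed-point : ∀ x → ¬ σ x ≡ x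
  σ-no-fixed-point x σx≡x = even≢odd (#inside * ℓ₁) ℓ (begin
    2 * (#inside * ℓ₁)     ≡⟨ *-comm 2 (#inside * ℓ₁) ⟩
    #inside * ℓ₁ * 2       ≡⟨ *-assoc #inside ℓ₁ 2 ⟩
    #inside * (ℓ₁ * 2)     ≡⟨ cong (#inside *_) (*-comm ℓ₁ 2) ⟩
    #inside * (2 * ℓ₁)     ≡⟨ cong (#inside *_) (sym (#G₁-self x)) ⟩
    #inside * #G₁ x x      ≡⟨ sym (double-count x x) ⟩
    #H x x + [σ x ≡ x ]    ≡⟨ cong₂ _+_ (#H-self x) (card-finite-≡ _≟_ σx≡x) ⟩
    2 * ℓ + 1              ≡⟨ +-comm (2 * ℓ) 1 ⟩
    1 + 2 * ℓ              ∎)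
    where
    open ≡-Reasoning
    ℓ₁ = card (finite-Loops G₁ (finite-point x))
    ℓ = card (finite-Loops H (finite-Column x))

  σ-involutive : ∀ x → σ (σ x) ≡ x
  σ-involutive x = σ-symmetric x (σ x) refl

  link : ∀ x → DartsBetween G₁ (_≡ x) (_≡ σ x)
  link x = proj₂ (Inverse.to (column-to-fibre↔ x (σ x))
                   (Inverse.from (column-to-fibre-split x (σ x)) (inj₂ refl)))

proposition6 : (n₁ n₂ : ℕ) (G₁ : Graph (Fin n₁)) (G₂ : Graph (Fin n₂))
    (H : Graph (Fin n₁ × Fin n₂)) →
    IsTightProduct G₁ G₂ H → HasBridge G₂ → HasPerfectMatching G₁
proposition6 _ _ G₁ G₂ _ (cov₁ , cov₂) (_ , bridge) with bridge⇒single-crossing G₂ bridge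
... | side , single-crossing =
  involution⇒perfect-matching G₁ σ σ-involutive σ-no-fixed-point link
  where open ColumnCounting cov₁ cov₂ side single-crossing
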